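{- Let $M\subseteq\mathbb{T}$ satisfy the standing hypothesis. The complete core $\mathrm{core}_{\curvearrowleft}(\rho^\forall_M)$ of the universal closure for time reversal exists, its set of fixpoints is $\{Y\subseteq\mathbb{T}\mid Y\text{ and }\curvearrowleft Y\text{ are both fixpoints of }\rho^\forall_M\}$, and $\mathrm{core}_{\curvearrowleft}(\rho^\forall_M)=\rho^\forall_M\sqcup\rho^\forall_{\curvearrowleft M}$.
   Context: $\mathbb{T}$ is the set of traces $\langle i,\sigma\rangle$, $i\in\mathbb{Z}$, $\sigma:\mathbb{Z}\to\mathbb{S}$; $X_{\downarrow s}=\{\langle i,\sigma\rangle\in X\mid\sigma_i=s\}$; $\oplus(X)=\{\langle i,\sigma\rangle\mid\langle i+1,\sigma\rangle\in X\}$, $\ominus(X)=\{\langle i,\sigma\rangle\mid\langle i-1,\sigma\rangle\in X\}$, $\curvearrowleft(X)=\{\langle -i,\lambda k.\sigma_{ -k}\rangle\mid\langle i,\sigma\rangle\in X\}$. Standing hypothesis on $M$: (i) $|M_{\downarrow s}|>1$ for all $s$; (ii) $\oplus(M)=M=\ominus(M)$ and $\oplus(\curvearrowleft M)=\curvearrowleft M=\ominus(\curvearrowleft M)$. For a model $N$, $\rho^\forall_N(X)=\{\langle i,\sigma\rangle\in N\mid N_{\downarrow\sigma_i}\subseteq X\}$. Upper closure operators on $\langle\wp(\mathbb{T}),\supseteq\rangle$: maps monotone w.r.t. $\subseteq$, idempotent, with $\rho(X)\subseteq X$; ordered by $\rho\sqsubseteq\eta$ iff $\rho(X)\supseteq\eta(X)$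 for all $X$; identified with their sets of fixpoints; the lub $\rho\sqcup\eta$ is the closure whose set of fixpoints is the intersection of their sets of fixpoints. $\rho$ is complete for $f$ if $\rho\circ f=\rho\circ f\circ\rho$. The complete core of $\rho$ for $f$ is the $\sqsubseteq$-least closure $\eta$ with $\rho\sqsubseteq\eta$ complete for $f$. -}

module Defs where

open import Level using (0ℓ)
open import Data.Integer using (ℤ; _+_; _-_; -_; 1ℤ)
open import Data.Integer.Properties using (neg-involutive)
open import Data.Product using (Σ; _×_; _,_; proj₁; proj₂; ∃)
open import Relation.Binary.PropositionalEquality using (_≡_; refl; sym; trans; cong; subst)
open import Relation.Nullary using (¬_)

Trace : Set → Set
Trace S = ℤ × (ℤ → S)

-- Equality of traces as elements of the set 𝕋 (functions equal iff pointwise equal).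
_≈T_ : {S : Set} → Trace S → Trace S → Set
(i , σ) ≈T (j , τ) = (i ≡ j) × (∀ k → σ k ≡ τ k)

state : {S : Set} → Trace S → S
state (i , σ) = σ i

record TSet (S : Set) : Set₁ where
  field
    mem  : Trace S → Set
    resp : ∀ {t t′} → t ≈T t′ → mem t → mem t′
open TSet public

_⊆_ : {S : Set} → TSet S → TSet S → Set
X ⊆ Y = ∀ t → mem X t → mem Y t

_≐_ : {S : Set} → TSet S → TSet S → Set
X ≐ Y = (X ⊆ Y) × (Y ⊆ X)

⊕ : {S : Set} → TSet S → TSet S
mem (⊕ X) (i , σ) = mem X (i + 1ℤ , σ)
resp (⊕ X) {i , σ} {j , τ} (refl , e) m = resp X (refl , e) m

⊖ : {S : Set} → TSet S → TSet S
mem (⊖ X) (i , σ) = mem X (i - 1ℤ , σ)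
resp (⊖ X) {i , σ} {j , τ} (refl , e) m = resp X (refl , e) m

rev : {S : Set} → Trace S → Trace S
rev (i , σ) = (- i , λ k → σ (- k))

↶ : {S : Set} → TSet S → TSet S
mem (↶ {S} X) t = Σ (Trace S) λ t′ → mem X t′ × (rev t′ ≈T t)
resp (↶ X) {t} {t′} (p , e) (u , m , (q , f)) =
  u , m , (trans q p , λ k → trans (f k) (e k))

_↓_ : {S : Set} → TSet S → S → Trace S → Set
(X ↓ s) t = mem X t × (state t ≡ s)

state-resp : {S : Set} {t t′ : Trace S} → t ≈T t′ → state t ≡ state t′
state-resp {t = i , σ} {j , τ} (refl , e) = e i

ρ∀ : {S : Set} → TSet S → TSet S → TSet S
mem (ρ∀ N X) t = mem N t × (∀ t′ → (N ↓ state t) t′ → mem X t′)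
resp (ρ∀ N X) {t} {t′} e (n , h) =
  resp N e n , λ u (nu , su) → h u (nu , trans su (sym (state-resp e)))

-- Standing hypothesis on M.
-- (i) |M↓s| > 1 for all s: two distinct traces of M with current state s.
-- (ii) ⊕M = M = ⊖M and ⊕(↶M) = ↶M = ⊖(↶M).
StandingHyp : {S : Set} → TSet S → Set
StandingHyp {S} M =
  (∀ (s : S) → Σ (Trace S) λ t → Σ (Trace S) λ t′ →
      (M ↓ s) t × (M ↓ s) t′ × ¬ (t ≈T t′))
  × ((⊕ M ≐ M) × (⊖ M ≐ M))
  × ((⊕ (↶ M) ≐ ↶ M) × (⊖ (↶ M) ≐ ↶ M))

-- Upper closure operators on ⟨℘(𝕋), ⊇⟩.
Op : Set → Set₁
Op S = TSet S → TSet S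

record IsUCO {S : Set} (ρ : Op S) : Set₁ where
  field
    monotone   : ∀ {X Y} → X ⊆ Y → ρ X ⊆ ρ Y
    idempotent : ∀ X → ρ (ρ X) ≐ ρ X
    reductive  : ∀ X → ρ X ⊆ X

_⊑_ : {S : Set} → Op S → Op S → Set₁
ρ ⊑ η = ∀ X → η X ⊆ ρ X

Fix : {S : Set} → Op S → TSet S → Set
Fix ρ X = ρ X ≐ X

Complete : {S : Set} → Op S → Op S → Set₁
Complete ρ f = ∀ X → ρ (f X) ≐ ρ (f (ρ X))

IsCompleteCore : {S : Set} → Op S → Op S → Op S → Set₁
IsCompleteCore ρ f η =
  IsUCO η × (ρ ⊑ η) × Complete η f
  × (∀ η′ → IsUCO η′ → ρ ⊑ η′ → Complete η′ f → η ⊑ η′)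

IsLub : {S : Set} → Op S → Op S → Op S → Set₁
IsLub ρ ρ′ η = IsUCO η × (∀ Y → (Fix η Y → Fix ρ Y × Fix ρ′ Y) × (Fix ρ Y × Fix ρ′ Y → Fix η Y))

{-# OPTIONS --safe #-}
module Submission where

open import Defs
open import Data.Product using (Σ; _×_; _,_; proj₁; proj₂)
open import Data.Sum using (_⊎_; inj₁; inj₂; [_,_])
open import Data.Integer using (-_)
open import Data.Integer.Properties using (neg-involutive)
open import Relation.Binary.PropositionalEquality using (_≡_; refl; sym; trans; cong)

-- The fixpoints of ρ∀_N are the N-saturated sets: subsets of N that contain,
-- with any trace, every trace of N with the same current state.  The sets that
-- are both N- and N′-saturated are the fixpoints of X ↦ ρ∀_{N∪N′}(N ∩ N′ ∩ X),
-- which is therefore the lub ρ∀_N ⊔ ρ∀_N′.  Time reversal preserves current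
-- states, so it exchanges M-saturated and ↶M-saturated sets; hence the lub for
-- N′ = ↶M is complete for ↶.  Conversely the fixpoints of any closure above
-- ρ∀_M that is complete for the involution ↶ are closed under ↶, so they are
-- both M- and ↶M-saturated, which makes that lub the least such closure.

module _ {S : Set} where

  private variable
    t u : Trace S
    N N′ K X X′ Y Y′ : TSet S

  ≈T-sym : t ≈T u → u ≈T t
  ≈T-sym (p , e) = sym p , λ k → sym (e k)

  ≈T-trans : {v : Trace S} → t ≈T u → u ≈T v → t ≈T v
  ≈T-trans (p , e) (q , f) = trans p q , λ k → trans (e k) (f k)

  rev-involutive : (t : Trace S) → rev (rev t) ≈T t
  rev-involutive (i , σ) = neg-involutive i , λ k → cong σ (neg-involutive k)

  rev-resp : t ≈T u → rev t ≈T rev u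
  rev-resp (p , e) = cong -_ p , λ k → e (- k)

  state-rev : (t : Trace S) → state (rev t) ≡ state t
  state-rev (i , σ) = cong σ (neg-involutive i)

  _∪_ : TSet S → TSet S → TSet S
  mem (X ∪ Y) t = mem X t ⊎ mem Y t
  resp (X ∪ Y) e = [ (λ x → inj₁ (resp X e x)) , (λ y → inj₂ (resp Y e y)) ]

  _∩_ : TSet S → TSet S → TSet S
  mem (X ∩ Y) t = mem X t × mem Y t
  resp (X ∩ Y) e (x , y) = resp X e x , resp Y e y

  infixr 7 _∩_
  infixr 6 _∪_

  ↶-intro : ∀ X → mem X t → mem (↶ X) (rev t)
  ↶-intro {t = t} X x = t , x , (refl , λ _ → refl)

  ↶-elim : ∀ X → mem (↶ X) t → mem X (rev t)
  ↶-elim X (u , x , e) =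
    resp X (≈T-trans (≈T-sym (rev-involutive u)) (rev-resp e)) x

  ↶-intro′ : ∀ X → mem X (rev t) → mem (↶ X) t
  ↶-intro′ {t = t} X x = resp (↶ X) (rev-involutive t) (↶-intro X x)

  ↶-mono : X ⊆ Y → ↶ X ⊆ ↶ Y
  ↶-mono X⊆Y _ (u , x , e) = u , X⊆Y u x , e

  ↶-involutive : ∀ X → ↶ (↶ X) ≐ X
  ↶-involutive X =
    (λ t x → resp X (rev-involutive t) (↶-elim X (↶-elim (↶ X) x))) ,
    (λ t x → ↶-intro′ (↶ X) (↶-intro X x))

  record Saturated (N Y : TSet S) : Set where
    field
      within : Y ⊆ N
      closed : ∀ t t′ → mem Y t → (N ↓ state t) t′ → mem Y t′
  open Saturated

  ρ∀-reductive : (N X : TSet S) → ρ∀ N X ⊆ X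
  ρ∀-reductive N X t (n , h) = h t (n , refl)

  ρ∀-saturated : (N X : TSet S) → Saturated N (ρ∀ N X)
  within (ρ∀-saturated N X) t = proj₁
  closed (ρ∀-saturated N X) t t′ (_ , h) (n′ , e) =
    n′ , λ u (nu , eu) → h u (nu , trans eu e)

  saturated⇒⊆ρ∀ : Saturated N Y → Y ⊆ X → Y ⊆ ρ∀ N X
  saturated⇒⊆ρ∀ sat Y⊆X t y = within sat t y , λ t′ n → Y⊆X t′ (closed sat t t′ y n)

  fix-ρ∀⇒saturated : Fix (ρ∀ N) Y → Saturated N Y
  within (fix-ρ∀⇒saturated (_ , Y⊆ρY)) t y = proj₁ (Y⊆ρY t y)
  closed (fix-ρ∀⇒saturated (_ , Y⊆ρY)) t t′ y = proj₂ (Y⊆ρY t y) t′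

  saturated⇒fix-ρ∀ : Saturated N Y → Fix (ρ∀ N) Y
  saturated⇒fix-ρ∀ {N = N} {Y = Y} sat =
    ρ∀-reductive N Y , saturated⇒⊆ρ∀ {X = Y} sat (λ _ y → y)

  saturated-congˡ : N ≐ N′ → Saturated N Y → Saturated N′ Y
  within (saturated-congˡ (N⊆N′ , _) sat) t y = N⊆N′ t (within sat t y)
  closed (saturated-congˡ (_ , N′⊆N) sat) t t′ y (n , e) =
    closed sat t t′ y (N′⊆N t′ n , e)

  saturated-congʳ : Y ≐ Y′ → Saturated N Y → Saturated N Y′
  within (saturated-congʳ (_ , Y′⊆Y) sat) t y′ = within sat t (Y′⊆Y t y′)
  closed (saturated-congʳ (Y⊆Y′ , Y′⊆Y) sat) t t′ y′ n =
    Y⊆Y′ t′ (closed sat t t′ (Y′⊆Y t y′) n)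

  saturated-restrict : N ⊆ K → Y ⊆ N → Saturated K Y → Saturated N Y
  within (saturated-restrict _ Y⊆N _) = Y⊆N
  closed (saturated-restrict N⊆K _ sat) t t′ y (n , e) = closed sat t t′ y (N⊆K t′ n , e)

  saturated-∪ : Saturated N Y → Saturated N′ Y → Saturated (N ∪ N′) Y
  within (saturated-∪ sat _) t y = inj₁ (within sat t y)
  closed (saturated-∪ sat _) t t′ y (inj₁ n , e) = closed sat t t′ y (n , e)
  closed (saturated-∪ _ sat′) t t′ y (inj₂ n , e) = closed sat′ t t′ y (n , e)

  saturated-↶ : Saturated N Y → Saturated (↶ N) (↶ Y)
  within (saturated-↶ {N = N} {Y = Y} sat) = ↶-mono {X = Y} {Y = N} (within sat)
  closed (saturated-↶ {N = N} {Y = Y} sat) t t′ y (n , e) =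
    ↶-intro′ Y (closed sat (rev t) (rev t′) (↶-elim Y y)
      (↶-elim N n , trans (state-rev t′) (trans e (sym (state-rev t)))))

  saturated-↶ʳ : Saturated N (↶ Y) → Saturated (↶ N) Y
  saturated-↶ʳ {N = N} {Y = Y} sat =
    saturated-congʳ (↶-involutive Y) (saturated-↶ sat)

  saturated-↶ˡ : Saturated (↶ N) Y → Saturated N (↶ Y)
  saturated-↶ˡ {N = N} {Y = Y} sat =
    saturated-congˡ (↶-involutive N) (saturated-↶ sat)

  ρ∀-lub : TSet S → TSet S → Op S
  ρ∀-lub N N′ X = ρ∀ (N ∪ N′) (N ∩ N′ ∩ X)

  module Lub (N N′ : TSet S) where

    ρ∀-lub⊆∩ : ∀ X → ρ∀-lub N N′ X ⊆ (N ∩ N′ ∩ X)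
    ρ∀-lub⊆∩ X = ρ∀-reductive (N ∪ N′) (N ∩ N′ ∩ X)

    ρ∀-lub-reductive : ∀ X → ρ∀-lub N N′ X ⊆ X
    ρ∀-lub-reductive X t m = proj₂ (proj₂ (ρ∀-lub⊆∩ X t m))

    ρ∀-lub-saturatedˡ : ∀ X → Saturated N (ρ∀-lub N N′ X)
    ρ∀-lub-saturatedˡ X =
      saturated-restrict (λ _ → inj₁) (λ t m → proj₁ (ρ∀-lub⊆∩ X t m))
        (ρ∀-saturated (N ∪ N′) (N ∩ N′ ∩ X))

    ρ∀-lub-saturatedʳ : ∀ X → Saturated N′ (ρ∀-lub N N′ X)
    ρ∀-lub-saturatedʳ X =
      saturated-restrict (λ _ → inj₂) (λ t m → proj₁ (proj₂ (ρ∀-lub⊆∩ X t m)))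
        (ρ∀-saturated (N ∪ N′) (N ∩ N′ ∩ X))

    saturated⇒⊆ρ∀-lub : ∀ X → Saturated N Y → Saturated N′ Y → Y ⊆ X → Y ⊆ ρ∀-lub N N′ X
    saturated⇒⊆ρ∀-lub X sat sat′ Y⊆X =
      saturated⇒⊆ρ∀ {X = N ∩ N′ ∩ X} (saturated-∪ sat sat′)
        (λ t y → within sat t y , within sat′ t y , Y⊆X t y)

    ρ∀-lub-mono : X ⊆ X′ → ρ∀-lub N N′ X ⊆ ρ∀-lub N N′ X′
    ρ∀-lub-mono {X = X} {X′ = X′} X⊆X′ =
      saturated⇒⊆ρ∀-lub X′ (ρ∀-lub-saturatedˡ X) (ρ∀-lub-saturatedʳ X)
        (λ t m → X⊆X′ t (ρ∀-lub-reductive X t m))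

    saturated⇒fix-ρ∀-lub : Saturated N Y → Saturated N′ Y → Fix (ρ∀-lub N N′) Y
    saturated⇒fix-ρ∀-lub {Y = Y} sat sat′ =
      ρ∀-lub-reductive Y , saturated⇒⊆ρ∀-lub Y sat sat′ (λ _ y → y)

    fix-ρ∀-lub⇒saturated : Fix (ρ∀-lub N N′) Y → Saturated N Y × Saturated N′ Y
    fix-ρ∀-lub⇒saturated {Y = Y} fix =
      saturated-congʳ fix (ρ∀-lub-saturatedˡ Y) ,
      saturated-congʳ fix (ρ∀-lub-saturatedʳ Y)

    ρ∀-lub-isUCO : IsUCO (ρ∀-lub N N′)
    ρ∀-lub-isUCO = record
      { monotone   = λ {X} {X′} → ρ∀-lub-mono {X = X} {X′ = X′}
      ; idempotent = λ X →
          saturated⇒fix-ρ∀-lub (ρ∀-lub-saturatedˡ X) (ρ∀-lub-saturatedʳ X)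
      ; reductive  = ρ∀-lub-reductive
      }

    ρ∀-lub-isLub : IsLub (ρ∀ N) (ρ∀ N′) (ρ∀-lub N N′)
    ρ∀-lub-isLub = ρ∀-lub-isUCO , λ Y →
      (λ fix → let (sat , sat′) = fix-ρ∀-lub⇒saturated {Y = Y} fix in
               saturated⇒fix-ρ∀ sat , saturated⇒fix-ρ∀ sat′) ,
      (λ (fix , fix′) →
         saturated⇒fix-ρ∀-lub {Y = Y} (fix-ρ∀⇒saturated fix) (fix-ρ∀⇒saturated fix′))

  ρ∀⊑⇒saturated : {η : Op S} → ρ∀ N ⊑ η → Fix η Y → Saturated N Y
  ρ∀⊑⇒saturated {N = N} {Y = Y} ρ∀N⊑η (_ , Y⊆ηY) =
    fix-ρ∀⇒saturated (ρ∀-reductive N Y , λ t y → ρ∀N⊑η Y t (Y⊆ηY t y))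

  complete-↶⇒fix-↶ : {η : Op S} → IsUCO η → Complete η ↶ → Fix η Y → Fix η (↶ Y)
  complete-↶⇒fix-↶ {Y = Y} {η = η} uco complete (_ , Y⊆ηY) =
    reductive (↶ Y) , ↶Y⊆η↶Y
    where
    open IsUCO uco
    -- Y ⊆ η Y ⊆ η (↶ ↶ Y) ≐ η (↶ (η (↶ Y))) ⊆ ↶ (η (↶ Y)), completeness being used at ↶ Y.
    Y⊆↶η↶Y : Y ⊆ ↶ (η (↶ Y))
    Y⊆↶η↶Y t y =
      reductive (↶ (η (↶ Y))) t
        (proj₁ (complete (↶ Y)) t
          (monotone (proj₂ (↶-involutive Y)) t (Y⊆ηY t y)))
    ↶Y⊆η↶Y : ↶ Y ⊆ η (↶ Y)
    ↶Y⊆η↶Y t y =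
      resp (η (↶ Y)) (rev-involutive t)
        (↶-elim (η (↶ Y)) (Y⊆↶η↶Y (rev t) (↶-elim Y y)))

  module _ (M : TSet S) where

    open Lub M (↶ M)

    core : Op S
    core = ρ∀-lub M (↶ M)

    ↶-core-↶ : ∀ X → ↶ (core (↶ X)) ⊆ core X
    ↶-core-↶ X =
      saturated⇒⊆ρ∀-lub X (saturated-↶ˡ sat↶M) (saturated-↶ satM) ↶core↶X⊆X
      where
      core↶X : TSet S
      core↶X = core (↶ X)
      satM : Saturated M core↶X
      satM = ρ∀-lub-saturatedˡ (↶ X)
      sat↶M : Saturated (↶ M) core↶X
      sat↶M = ρ∀-lub-saturatedʳ (↶ X)
      ↶core↶X⊆X : ↶ core↶X ⊆ X
      ↶core↶X⊆X t y =
        proj₁ (↶-involutive X) t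
          (↶-mono {X = core↶X} {Y = ↶ X} (ρ∀-lub-reductive (↶ X)) t y)

    core-complete : Complete core ↶
    core-complete X =
      core↶X⊆core↶coreX ,
      ρ∀-lub-mono {X = ↶ (core X)} {X′ = ↶ X}
        (↶-mono {X = core X} {Y = X} (ρ∀-lub-reductive X))
      where
      core↶X⊆core↶coreX : core (↶ X) ⊆ core (↶ (core X))
      core↶X⊆core↶coreX =
        saturated⇒⊆ρ∀-lub (↶ (core X)) (ρ∀-lub-saturatedˡ (↶ X)) (ρ∀-lub-saturatedʳ (↶ X))
          (λ t y → ↶-intro′ (core X) (↶-core-↶ X (rev t) (↶-intro (core (↶ X)) y)))

    core-above : ρ∀ M ⊑ core
    core-above X =
      saturated⇒⊆ρ∀ {X = X} (ρ∀-lub-saturatedˡ X) (ρ∀-lub-reductive X)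

    core-least : ∀ η → IsUCO η → ρ∀ M ⊑ η → Complete η ↶ → core ⊑ η
    core-least η uco ρ∀M⊑η complete X =
      saturated⇒⊆ρ∀-lub X sat (saturated-↶ʳ sat↶) (reductive X)
      where
      open IsUCO uco
      fix : Fix η (η X)
      fix = idempotent X
      sat : Saturated M (η X)
      sat = ρ∀⊑⇒saturated {η = η} ρ∀M⊑η fix
      sat↶ : Saturated M (↶ (η X))
      sat↶ = ρ∀⊑⇒saturated {η = η} ρ∀M⊑η (complete-↶⇒fix-↶ uco complete fix)

    core-isCompleteCore : IsCompleteCore (ρ∀ M) ↶ core
    core-isCompleteCore = ρ∀-lub-isUCO , core-above , core-complete , core-least

    core-isLub : IsLub (ρ∀ M) (ρ∀ (↶ M)) core
    core-isLub = ρ∀-lub-isLub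

    fix-core⇒fix-ρ∀ : Fix core Y → Fix (ρ∀ M) Y × Fix (ρ∀ M) (↶ Y)
    fix-core⇒fix-ρ∀ {Y = Y} fix =
      let (sat , sat↶) = fix-ρ∀-lub⇒saturated {Y = Y} fix
      in saturated⇒fix-ρ∀ sat , saturated⇒fix-ρ∀ (saturated-↶ˡ {N = M} sat↶)

    fix-ρ∀⇒fix-core : Fix (ρ∀ M) Y × Fix (ρ∀ M) (↶ Y) → Fix core Y
    fix-ρ∀⇒fix-core {Y = Y} (fix , fix↶) =
      saturated⇒fix-ρ∀-lub {Y = Y}
        (fix-ρ∀⇒saturated fix) (saturated-↶ʳ {N = M} (fix-ρ∀⇒saturated fix↶))

theorem11 : {S : Set} (M : TSet S) → StandingHyp M →
    Σ (Op S) λ η →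
      IsCompleteCore (ρ∀ M) ↶ η
      × (∀ Y → (Fix η Y → Fix (ρ∀ M) Y × Fix (ρ∀ M) (↶ Y))
             × (Fix (ρ∀ M) Y × Fix (ρ∀ M) (↶ Y) → Fix η Y))
      × IsLub (ρ∀ M) (ρ∀ (↶ M)) η
theorem11 M _ =
  core M ,
  core-isCompleteCore M ,
  (λ Y → fix-core⇒fix-ρ∀ M {Y = Y} , fix-ρ∀⇒fix-core M {Y = Y}) ,
  core-isLub M
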